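{- Let $m_1,m_2\in\mathbb{N}$, $m=\operatorname{lcm}[m_1,m_2]$, $M\in\mathbb{N}$ with $m\mid M$, and $a\in\mathbb{Z}$ with $\gcd(a,m)=1$. Then \[ \frac{1}{\phi(M)}\sum_{\substack{k=1\\ \gcd(k,M)=1}}^{M}\gcd(k-a,m_1)\gcd(k-a,m_2)=\sum_{d_1\mid m_1,\,d_2\mid m_2}\phi(\gcd(d_1,d_2)). \]
   Context: $\mathbb{N}=\{1,2,\ldots\}$; $\phi$ is Euler's totient function. -}

module Defs where

open import Data.Nat using (ℕ; zero; suc; _+_; _*_; _≟_)
open import Data.Nat.GCD using (gcd)
open import Data.Nat.Divisibility using (_∣?_)
open import Data.List using (List; filter; map; length; upTo; concatMap)
open import Data.Nat.ListAction using (sum)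
open import Data.Integer using (ℤ; +_; _-_; ∣_∣)
open import Relation.Nullary.Decidable using (does)
open import Data.Bool using (if_then_else_)

range1 : ℕ → List ℕ
range1 n = map suc (upTo n)

reducedResidues : ℕ → List ℕ
reducedResidues M = filter (λ k → gcd k M ≟ 1) (range1 M)

φ : ℕ → ℕ
φ n = length (reducedResidues n)

divisors : ℕ → List ℕ
divisors n = filter (λ d → d ∣? n) (range1 n)

gcdℤ : ℤ → ℕ → ℕ
gcdℤ x m = gcd ∣ x ∣ m

lhsSum : ℕ → ℤ → ℕ → ℕ → ℕ
lhsSum M a m₁ m₂ =
  sum (map (λ k → gcdℤ (+ k - a) m₁ * gcdℤ (+ k - a) m₂) (reducedResidues M))

rhsSum : ℕ → ℕ → ℕ
rhsSum m₁ m₂ =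
  sum (concatMap (λ d₁ → map (λ d₂ → φ (gcd d₁ d₂)) (divisors m₂)) (divisors m₁))

module Submission where

-- Expanding both gcds with Gauss's identity gcd(x, n) = Σ_{d ∣ n, d ∣ x} φ(d) and exchanging
-- the sums, the left side becomes Σ_{d₁∣m₁, d₂∣m₂} φ(d₁)φ(d₂)·N, where N is the number of units
-- k ≤ M with k ≡ a modulo ℓ = lcm(d₁, d₂).  Two facts then give φ(M)·φ(gcd(d₁, d₂)) per pair:
--   * equidistribution: every unit class modulo ℓ ∣ M contains φ(M)/φ(ℓ) units modulo M;
--   * φ(d₁)·φ(d₂) = φ(lcm(d₁, d₂))·φ(gcd(d₁, d₂)).

open import Defs
open import Data.Bool using (if_then_else_)
open import Data.Empty using (⊥-elim)
open import Data.Integer as ℤ using (ℤ; ∣_∣; _%ℕ_; _/ℕ_)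
open import Data.Integer.DivMod using (a≡a%ℕn+[a/ℕn]*n)
import Data.Integer.Divisibility.Signed as ℤ∣
open ℤ∣ using (∣ᵤ⇒∣; ∣⇒∣ᵤ)
open import Data.Integer.Properties using (m-n≡m⊖n; ∣⊖∣-≤; ∣m⊖n∣≡∣n⊖m∣)
open import Data.Integer.Tactic.RingSolver using () renaming (solve-∀ to ℤ-solve-∀)
open import Data.List using (List; []; _∷_; [_]; _++_; _∷ʳ_; map; filter; upTo; concatMap; length)
open import Data.List.Properties using (map-++; map-∘; upTo-∷ʳ)
open import Data.Nat
open import Data.Nat.Coprimality as Coprime using (Coprime; coprime-divisor; 1-coprimeTo; coprime⇒gcd≡1; gcd≡1⇒coprime)
open import Data.Nat.Divisibility
open import Data.Nat.DivMod
open import Data.Nat.GCD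
open import Data.Nat.Induction using (<-rec)
open import Data.Nat.LCM
open import Data.Nat.ListAction using (sum)
open import Data.Nat.ListAction.Properties using (sum-++)
open import Data.Nat.Properties
open import Algebra.Properties.CommutativeSemigroup +-commutativeSemigroup using () renaming (interchange to +-interchange)
open import Algebra.Properties.CommutativeSemigroup *-commutativeSemigroup using ()
  renaming (x∙yz≈y∙xz to x*[y*z]≡y*[x*z]; x∙yz≈y∙zx to x*[y*z]≡y*[z*x])
open import Data.Nat.Tactic.RingSolver using (solve-∀)
open import Data.Product using (_×_; _,_; proj₁; proj₂)
open import Data.Sum using (_⊎_; inj₁; inj₂)
open import Function using (_∘_)
open import Relation.Binary.PropositionalEquality using (_≡_; refl; sym; trans; cong; cong₂; subst; ≢-sym; module ≡-Reasoning)
open import Relation.Nullary using (Dec; yes; no; ¬_; does)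
open import Relation.Nullary.Decidable using (_×-dec_)

𝟙 : ∀ {p} {A : Set p} → Dec A → ℕ
𝟙 d = if does d then 1 else 0

module _ {p} {A : Set p} where

  𝟙-yes : (d : Dec A) → A → 𝟙 d ≡ 1
  𝟙-yes (yes _) _ = refl
  𝟙-yes (no ¬a) a = ⊥-elim (¬a a)

  𝟙-no : (d : Dec A) → ¬ A → 𝟙 d ≡ 0
  𝟙-no (yes a) ¬a = ⊥-elim (¬a a)
  𝟙-no (no _) _ = refl

  𝟙-guard : (d : Dec A) {x y : ℕ} → (A → x ≡ y) → 𝟙 d * x ≡ 𝟙 d * y
  𝟙-guard (yes a) eq = cong (1 *_) (eq a)
  𝟙-guard (no _) _ = refl

  𝟙-guardʳ : (d : Dec A) {x y : ℕ} → (A → x ≡ y) → x * 𝟙 d ≡ y * 𝟙 d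
  𝟙-guardʳ d {x} {y} eq = trans (*-comm x (𝟙 d)) (trans (𝟙-guard d eq) (*-comm (𝟙 d) y))

  𝟙-kill : (d : Dec A) → ¬ A → ∀ x → 𝟙 d * x ≡ 0
  𝟙-kill d ¬a x = cong (_* x) (𝟙-no d ¬a)

  𝟙-keep : (d : Dec A) → A → ∀ x → 𝟙 d * x ≡ x
  𝟙-keep d a x = trans (cong (_* x) (𝟙-yes d a)) (*-identityˡ x)

𝟙-cong : ∀ {p q} {A : Set p} {B : Set q} (d : Dec A) (e : Dec B) → (A → B) → (B → A) → 𝟙 d ≡ 𝟙 e
𝟙-cong (yes a) (yes b) f g = refl
𝟙-cong (yes a) (no ¬b) f g = ⊥-elim (¬b (f a))
𝟙-cong (no ¬a) (yes b) f g = ⊥-elim (¬a (g b))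
𝟙-cong (no ¬a) (no ¬b) f g = refl

𝟙-weaken : ∀ {p q} {A : Set p} {B : Set q} (d : Dec A) (e : Dec B) → (A → B) → ∀ x → 𝟙 d * x ≡ 𝟙 e * (𝟙 d * x)
𝟙-weaken (yes a) e a⇒b x = sym (𝟙-keep e (a⇒b a) (1 * x))
𝟙-weaken (no _) e _ x = sym (*-zeroʳ (𝟙 e))

𝟙-≡-sym : ∀ (x y : ℕ) → 𝟙 (x ≟ y) ≡ 𝟙 (y ≟ x)
𝟙-≡-sym x y = 𝟙-cong (x ≟ y) (y ≟ x) sym sym

𝟙-* : ∀ {p q r} {A : Set p} {B : Set q} {C : Set r} (d : Dec A) (e : Dec B) (f : Dec C) →
      (A → B → C) → (C → A) → (C → B) → 𝟙 d * 𝟙 e ≡ 𝟙 f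
𝟙-* (yes a) (yes b) f both _ _ = sym (𝟙-yes f (both a b))
𝟙-* (yes a) (no ¬b) f _ _ right = sym (𝟙-no f (λ c → ¬b (right c)))
𝟙-* (no ¬a) e f _ left _ = sym (𝟙-no f (λ c → ¬a (left c)))

Σ< : ℕ → (ℕ → ℕ) → ℕ
Σ< zero f = 0
Σ< (suc n) f = Σ< n f + f n

Σ₁ : ℕ → (ℕ → ℕ) → ℕ
Σ₁ n f = Σ< n (λ i → f (suc i))

Σ-cong : ∀ n {f g : ℕ → ℕ} → (∀ i → i < n → f i ≡ g i) → Σ< n f ≡ Σ< n g
Σ-cong zero h = refl
Σ-cong (suc n) h = cong₂ _+_ (Σ-cong n (λ i i<n → h i (m<n⇒m<1+n i<n))) (h n ≤-refl)

Σ₁-cong : ∀ n {f g : ℕ → ℕ} → (∀ i → 1 ≤ i → i ≤ n → f i ≡ g i) → Σ₁ n f ≡ Σ₁ n g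
Σ₁-cong n h = Σ-cong n (λ i i<n → h (suc i) (s≤s z≤n) i<n)

Σ-+ : ∀ n (f g : ℕ → ℕ) → Σ< n (λ i → f i + g i) ≡ Σ< n f + Σ< n g
Σ-+ zero f g = refl
Σ-+ (suc n) f g rewrite Σ-+ n f g = +-interchange (Σ< n f) (Σ< n g) (f n) (g n)

Σ-*ˡ : ∀ n c (f : ℕ → ℕ) → Σ< n (λ i → c * f i) ≡ c * Σ< n f
Σ-*ˡ zero c f = sym (*-zeroʳ c)
Σ-*ˡ (suc n) c f rewrite Σ-*ˡ n c f = sym (*-distribˡ-+ c (Σ< n f) (f n))

Σ-*ʳ : ∀ n c (f : ℕ → ℕ) → Σ< n (λ i → f i * c) ≡ Σ< n f * c
Σ-*ʳ n c f = trans (Σ-cong n (λ i _ → *-comm (f i) c)) (trans (Σ-*ˡ n c f) (*-comm c (Σ< n f)))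

Σ-zero : ∀ n (f : ℕ → ℕ) → (∀ i → i < n → f i ≡ 0) → Σ< n f ≡ 0
Σ-zero n f h = trans (Σ-cong n h) (zeros n)
  where
  zeros : ∀ n → Σ< n (λ _ → 0) ≡ 0
  zeros zero = refl
  zeros (suc n) = cong (_+ 0) (zeros n)

Σ-const : ∀ n c → Σ< n (λ _ → c) ≡ n * c
Σ-const zero c = refl
Σ-const (suc n) c rewrite Σ-const n c = +-comm (n * c) c

Σ-swap : ∀ n m (f : ℕ → ℕ → ℕ) → Σ< n (λ i → Σ< m (λ j → f i j)) ≡ Σ< m (λ j → Σ< n (λ i → f i j))
Σ-swap zero m f = sym (Σ-zero m _ (λ _ _ → refl))
Σ-swap (suc n) m f rewrite Σ-swap n m f = sym (Σ-+ m (λ j → Σ< n (λ i → f i j)) (λ j → f n j))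

Σ₁-swap : ∀ n m (f : ℕ → ℕ → ℕ) → Σ₁ n (λ i → Σ₁ m (λ j → f i j)) ≡ Σ₁ m (λ j → Σ₁ n (λ i → f i j))
Σ₁-swap n m f = Σ-swap n m (λ i j → f (suc i) (suc j))

Σ-split : ∀ a b (f : ℕ → ℕ) → Σ< (a + b) f ≡ Σ< a f + Σ< b (λ i → f (a + i))
Σ-split a zero f rewrite +-identityʳ a = sym (+-identityʳ _)
Σ-split a (suc b) f rewrite +-suc a b | Σ-split a b f = +-assoc (Σ< a f) _ (f (a + b))

Σ-mono : ∀ n (f g : ℕ → ℕ) → (∀ i → i < n → f i ≤ g i) → Σ< n f ≤ Σ< n g
Σ-mono zero f g h = z≤n
Σ-mono (suc n) f g h = +-mono-≤ (Σ-mono n f g (λ i i<n → h i (m<n⇒m<1+n i<n))) (h n ≤-refl)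

+-≤-both-equal : ∀ {a b c d} → a ≤ b → c ≤ d → a + c ≡ b + d → a ≡ b × c ≡ d
+-≤-both-equal a≤b c≤d eq with m≤n⇒m<n∨m≡n a≤b | m≤n⇒m<n∨m≡n c≤d
... | inj₂ a≡b | inj₂ c≡d = a≡b , c≡d
... | inj₁ a<b | _ = ⊥-elim (<-irrefl eq (+-mono-<-≤ a<b c≤d))
... | inj₂ a≡b | inj₁ c<d = ⊥-elim (<-irrefl eq (+-mono-≤-< (≤-reflexive a≡b) c<d))

Σ-squeeze : ∀ n (f g : ℕ → ℕ) → (∀ i → i < n → f i ≤ g i) → Σ< n f ≡ Σ< n g →
            ∀ i → i < n → f i ≡ g i
Σ-squeeze (suc n) f g f≤g sums i i<1+n = pick (m≤n⇒m<n∨m≡n (s≤s⁻¹ i<1+n))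
  where
  f≤g′ : ∀ i → i < n → f i ≤ g i
  f≤g′ i i<n = f≤g i (m<n⇒m<1+n i<n)
  parts : Σ< n f ≡ Σ< n g × f n ≡ g n
  parts = +-≤-both-equal (Σ-mono n f g f≤g′) (f≤g n ≤-refl) sums
  pick : i < n ⊎ i ≡ n → f i ≡ g i
  pick (inj₁ i<n) = Σ-squeeze n f g f≤g′ (proj₁ parts) i i<n
  pick (inj₂ refl) = proj₂ parts

Σ-single : ∀ n v (f : ℕ → ℕ) → v < n → Σ< n (λ i → 𝟙 (i ≟ v) * f i) ≡ f v
Σ-single (suc n) v f v<1+n with n ≟ v
... | yes refl = cong₂ _+_ (Σ-zero n _ others) (𝟙-keep (n ≟ n) refl (f n))
  where
  others : ∀ i → i < n → 𝟙 (i ≟ n) * f i ≡ 0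
  others i i<n = 𝟙-kill (i ≟ n) (λ i≡n → <-irrefl i≡n i<n) (f i)
... | no n≢v = trans (cong (Σ< n (λ i → 𝟙 (i ≟ v) * f i) +_) (𝟙-kill (n ≟ v) n≢v (f n)))
                   (trans (+-identityʳ _) (Σ-single n v f (≤∧≢⇒< (s≤s⁻¹ v<1+n) (≢-sym n≢v))))

Σ₁-single : ∀ n v (f : ℕ → ℕ) → 1 ≤ v → v ≤ n → Σ₁ n (λ e → 𝟙 (e ≟ v) * f e) ≡ f v
Σ₁-single n (suc v) f _ v<n = trans
  (Σ-cong n (λ i _ → cong (_* f (suc i)) (𝟙-cong (suc i ≟ suc v) (i ≟ v) suc-injective (cong suc))))
  (Σ-single n v (λ i → f (suc i)) v<n)

Σ-atMostOne : ∀ n {P : ℕ → Set} (P? : ∀ i → Dec (P i)) →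
              (∀ i j → i < n → j < n → P i → P j → i ≡ j) → Σ< n (λ i → 𝟙 (P? i)) ≤ 1
Σ-atMostOne zero P? unique = z≤n
Σ-atMostOne (suc n) P? unique with P? n
... | yes pn = ≤-reflexive (cong (_+ 1) (Σ-zero n _ none))
  where
  none : ∀ i → i < n → 𝟙 (P? i) ≡ 0
  none i i<n = 𝟙-no (P? i) (λ pi → <-irrefl (unique i n (m<n⇒m<1+n i<n) ≤-refl pi pn) i<n)
... | no _ = ≤-trans (≤-reflexive (+-identityʳ _))
                     (Σ-atMostOne n P? (λ i j i<n j<n → unique i j (m<n⇒m<1+n i<n) (m<n⇒m<1+n j<n)))

Σ-periodic : ∀ q L (g : ℕ → ℕ) → (∀ i → g (L + i) ≡ g i) → Σ< (q * L) g ≡ q * Σ< L g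
Σ-periodic zero L g per = refl
Σ-periodic (suc q) L g per = begin
  Σ< (L + q * L) g                          ≡⟨ Σ-split L (q * L) g ⟩
  Σ< L g + Σ< (q * L) (λ i → g (L + i))     ≡⟨ cong (Σ< L g +_) (Σ-cong (q * L) (λ i _ → per i)) ⟩
  Σ< L g + Σ< (q * L) g                     ≡⟨ cong (Σ< L g +_) (Σ-periodic q L g per) ⟩
  Σ< L g + q * Σ< L g                       ∎
  where open ≡-Reasoning

Σ₁-periodic : ∀ q L (f : ℕ → ℕ) → (∀ k → f (L + k) ≡ f k) → Σ₁ (q * L) f ≡ q * Σ₁ L f
Σ₁-periodic q L f per = Σ-periodic q L (λ i → f (suc i)) (λ i → trans (cong f (sym (+-suc L i))) (per (suc i)))

sum-upTo : ∀ n (f : ℕ → ℕ) → sum (map f (upTo n)) ≡ Σ< n f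
sum-upTo zero f = refl
sum-upTo (suc n) f = begin
  sum (map f (upTo (suc n)))          ≡⟨ cong (sum ∘ map f) (upTo-∷ʳ n) ⟨
  sum (map f (upTo n ∷ʳ n))           ≡⟨ cong sum (map-++ f (upTo n) [ n ]) ⟩
  sum (map f (upTo n) ++ [ f n ])     ≡⟨ sum-++ (map f (upTo n)) [ f n ] ⟩
  sum (map f (upTo n)) + (f n + 0)    ≡⟨ cong₂ _+_ (sum-upTo n f) (+-identityʳ (f n)) ⟩
  Σ< n f + f n                        ∎
  where open ≡-Reasoning

sum-range : ∀ n (f : ℕ → ℕ) → sum (map f (map suc (upTo n))) ≡ Σ₁ n f
sum-range n f = trans (cong sum (sym (map-∘ (upTo n)))) (sum-upTo n (f ∘ suc))

sum-filter : ∀ {P : ℕ → Set} (P? : ∀ x → Dec (P x)) (f : ℕ → ℕ) xs →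
             sum (map f (filter P? xs)) ≡ sum (map (λ x → 𝟙 (P? x) * f x) xs)
sum-filter P? f [] = refl
sum-filter P? f (x ∷ xs) with P? x
... | yes _ = cong₂ _+_ (sym (+-identityʳ (f x))) (sum-filter P? f xs)
... | no _ = sum-filter P? f xs

length-filter : ∀ {P : ℕ → Set} (P? : ∀ x → Dec (P x)) xs →
                length (filter P? xs) ≡ sum (map (λ x → 𝟙 (P? x)) xs)
length-filter P? [] = refl
length-filter P? (x ∷ xs) with P? x
... | yes _ = cong suc (length-filter P? xs)
... | no _ = length-filter P? xs

sum-concatMap : ∀ (g : ℕ → List ℕ) xs → sum (concatMap g xs) ≡ sum (map (sum ∘ g) xs)
sum-concatMap g [] = refl
sum-concatMap g (x ∷ xs) = trans (sum-++ (g x) (concatMap g xs)) (cong (sum (g x) +_) (sum-concatMap g xs))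

%≡⇒∣∸ : ∀ {L x y} .{{_ : NonZero L}} → x % L ≡ y % L → x ≤ y → L ∣ y ∸ x
%≡⇒∣∸ {L} {x} {y} eq x≤y = divides (y / L ∸ x / L) (begin
    y ∸ x                                       ≡⟨ cong₂ _∸_ (m≡m%n+[m/n]*n y L) (m≡m%n+[m/n]*n x L) ⟩
    (y % L + y / L * L) ∸ (x % L + x / L * L)   ≡⟨ cong (λ z → (y % L + y / L * L) ∸ (z + x / L * L)) eq ⟩
    (y % L + y / L * L) ∸ (y % L + x / L * L)   ≡⟨ [m+n]∸[m+o]≡n∸o (y % L) _ _ ⟩
    y / L * L ∸ x / L * L                       ≡⟨ *-distribʳ-∸ L (y / L) (x / L) ⟨
    (y / L ∸ x / L) * L                         ∎)
  where open ≡-Reasoning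

∣∸⇒%≡ : ∀ {L x y} .{{_ : NonZero L}} → x ≤ y → L ∣ y ∸ x → x % L ≡ y % L
∣∸⇒%≡ {L} {x} {y} x≤y L∣y∸x = trans (sym (%-remove-+ʳ x L∣y∸x)) (cong (_% L) (m+[n∸m]≡n x≤y))

∣∧<⇒≡0 : ∀ {L z} → L ∣ z → z < L → z ≡ 0
∣∧<⇒≡0 {z = zero} _ _ = refl
∣∧<⇒≡0 {z = suc z} L∣z z<L = ⊥-elim (<⇒≱ z<L (∣⇒≤ L∣z))

∣∸⇒≡ : ∀ {L x y} → 1 ≤ x → x ≤ y → y ≤ L → L ∣ y ∸ x → x ≡ y
∣∸⇒≡ 1≤x x≤y y≤L L∣y∸x =
  ≤-antisym x≤y (m∸n≡0⇒m≤n (∣∧<⇒≡0 L∣y∸x (<-≤-trans (∸-monoʳ-< {o = 0} 1≤x x≤y) y≤L)))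

%≡⇒≡ : ∀ {L x y} .{{_ : NonZero L}} → 1 ≤ x → x ≤ L → 1 ≤ y → y ≤ L → x % L ≡ y % L → x ≡ y
%≡⇒≡ {x = x} {y} 1≤x x≤L 1≤y y≤L eq with ≤-total x y
... | inj₁ x≤y = ∣∸⇒≡ 1≤x x≤y y≤L (%≡⇒∣∸ eq x≤y)
... | inj₂ y≤x = sym (∣∸⇒≡ 1≤y y≤x x≤L (%≡⇒∣∸ (sym eq) y≤x))

%≡-∣ : ∀ {d L x y} .{{_ : NonZero d}} .{{_ : NonZero L}} → d ∣ L → x % L ≡ y % L → x % d ≡ y % d
%≡-∣ {d} {L} {x} {y} d∣L eq =
  trans (sym (m∣n⇒o%n%m≡o%m d L x d∣L)) (trans (cong (_% d) eq) (m∣n⇒o%n%m≡o%m d L y d∣L))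

%≡-lcm : ∀ {d₁ d₂ x y} .{{_ : NonZero d₁}} .{{_ : NonZero d₂}} .{{_ : NonZero (lcm d₁ d₂)}} →
         x % d₁ ≡ y % d₁ → x % d₂ ≡ y % d₂ → x % lcm d₁ d₂ ≡ y % lcm d₁ d₂
%≡-lcm {x = x} {y} e₁ e₂ with ≤-total x y
... | inj₁ x≤y = ∣∸⇒%≡ x≤y (lcm-least (%≡⇒∣∸ e₁ x≤y) (%≡⇒∣∸ e₂ x≤y))
... | inj₂ y≤x = sym (∣∸⇒%≡ y≤x (lcm-least (%≡⇒∣∸ (sym e₁) y≤x) (%≡⇒∣∸ (sym e₂) y≤x)))

cancel-∣∸ : ∀ {L c x y} .{{_ : NonZero L}} → Coprime c L → x ≤ y → (c * x) % L ≡ (c * y) % L → L ∣ y ∸ x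
cancel-∣∸ {L} {c} {x} {y} c⊥L x≤y eq = coprime-divisor (Coprime.sym c⊥L)
  (subst (L ∣_) (sym (*-distribˡ-∸ c y x)) (%≡⇒∣∸ eq (*-monoʳ-≤ c x≤y)))

%≡-cancel : ∀ {L c x y} .{{_ : NonZero L}} → Coprime c L → (c * x) % L ≡ (c * y) % L → x % L ≡ y % L
%≡-cancel {x = x} {y} c⊥L eq with ≤-total x y
... | inj₁ x≤y = ∣∸⇒%≡ x≤y (cancel-∣∸ c⊥L x≤y eq)
... | inj₂ y≤x = sym (∣∸⇒%≡ y≤x (cancel-∣∸ c⊥L y≤x (sym eq)))

coprime-%≡ : ∀ {L x y} .{{_ : NonZero L}} → x % L ≡ y % L → Coprime x L → Coprime y L
coprime-%≡ eq x⊥L (d∣y , d∣L) = x⊥L (∣n∣m%n⇒∣m d∣L (subst (_ ∣_) (sym eq) (%-presˡ-∣ d∣y d∣L)) , d∣L)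

coprime-∣ʳ : ∀ {x L e} → Coprime x L → e ∣ L → Coprime x e
coprime-∣ʳ x⊥L e∣L (d∣x , d∣e) = x⊥L (d∣x , ∣-trans d∣e e∣L)

coprime-∣ˡ : ∀ {x L e} → Coprime x L → e ∣ x → Coprime e L
coprime-∣ˡ x⊥L e∣x (d∣e , d∣L) = x⊥L (∣-trans d∣e e∣x , d∣L)

coprime-* : ∀ {c d L} → Coprime c L → Coprime d L → Coprime (c * d) L
coprime-* {c} {d} {L} c⊥L d⊥L {e} (e∣cd , e∣L) = d⊥L (coprime-divisor e⊥c e∣cd , e∣L)
  where
  e⊥c : Coprime e c
  e⊥c (f∣e , f∣c) = c⊥L (f∣c , ∣-trans f∣e e∣L)

coprime-lcm : ∀ {x a b} → Coprime x a → Coprime x b → Coprime x (lcm a b)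
coprime-lcm {x} {a} {b} x⊥a x⊥b =
  coprime-∣ʳ (Coprime.sym (coprime-* (Coprime.sym x⊥a) (Coprime.sym x⊥b))) (lcm-least {a} {b} (m∣m*n b) (n∣m*n a))

-- Each residue is hit at most once by
-- cancellation, and the L points hit L residues in total, so the counting
-- principle forces every count to be exactly 1.
linear-hits-once : ∀ L c v .{{_ : NonZero L}} → Coprime c L → v < L →
                   Σ₁ L (λ k → 𝟙 ((c * k) % L ≟ v)) ≡ 1
linear-hits-once L c v c⊥L v<L = Σ-squeeze L hits (λ _ → 1) at-most-once total v v<L
  where
  hits : ℕ → ℕ
  hits w = Σ₁ L (λ k → 𝟙 ((c * k) % L ≟ w))
  at-most-once : ∀ w → w < L → hits w ≤ 1
  at-most-once w _ = Σ-atMostOne L (λ i → (c * suc i) % L ≟ w) injective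
    where
    injective : ∀ i j → i < L → j < L → (c * suc i) % L ≡ w → (c * suc j) % L ≡ w → i ≡ j
    injective i j i<L j<L eqᵢ eqⱼ =
      suc-injective (%≡⇒≡ (s≤s z≤n) i<L (s≤s z≤n) j<L (%≡-cancel c⊥L (trans eqᵢ (sym eqⱼ))))
  one-residue-each : ∀ k → Σ< L (λ w → 𝟙 ((c * k) % L ≟ w)) ≡ 1
  one-residue-each k = trans (Σ-cong L (λ w _ → trans (𝟙-≡-sym ((c * k) % L) w) (sym (*-identityʳ _))))
                             (Σ-single L ((c * k) % L) (λ _ → 1) (m%n<n (c * k) L))
  total : Σ< L hits ≡ Σ< L (λ _ → 1)
  total = begin
    Σ< L hits                                       ≡⟨ Σ-swap L L (λ w i → 𝟙 ((c * suc i) % L ≟ w)) ⟩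
    Σ₁ L (λ k → Σ< L (λ w → 𝟙 ((c * k) % L ≟ w)))   ≡⟨ Σ₁-cong L (λ k _ _ → one-residue-each k) ⟩
    Σ₁ L (λ _ → 1)                                  ∎
    where open ≡-Reasoning

linear-congruence-count : ∀ q L c r .{{_ : NonZero L}} → Coprime c L →
                          Σ₁ (q * L) (λ k → 𝟙 ((c * k) % L ≟ r % L)) ≡ q
linear-congruence-count q L c r c⊥L = begin
  Σ₁ (q * L) (λ k → 𝟙 ((c * k) % L ≟ r % L))   ≡⟨ Σ₁-periodic q L _ periodic ⟩
  q * Σ₁ L (λ k → 𝟙 ((c * k) % L ≟ r % L))     ≡⟨ cong (q *_) (linear-hits-once L c (r % L) c⊥L (m%n<n r L)) ⟩
  q * 1                                        ≡⟨ *-identityʳ q ⟩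
  q                                            ∎
  where
  open ≡-Reasoning
  periodic : ∀ k → 𝟙 ((c * (L + k)) % L ≟ r % L) ≡ 𝟙 ((c * k) % L ≟ r % L)
  periodic k = cong (λ z → 𝟙 (z ≟ r % L))
    (trans (cong (_% L) (*-distribˡ-+ c L k)) (%-remove-+ˡ (c * k) (n∣m*n c)))

congruence-count : ∀ q L r .{{_ : NonZero L}} → Σ₁ (q * L) (λ k → 𝟙 (k % L ≟ r % L)) ≡ q
congruence-count q L r = trans (Σ₁-cong (q * L) (λ k _ _ → cong (λ z → 𝟙 (z % L ≟ r % L)) (sym (*-identityˡ k))))
                               (linear-congruence-count q L 1 r (1-coprimeTo L))

unique-representative : ∀ L k .{{_ : NonZero L}} → Σ₁ L (λ r → 𝟙 (r % L ≟ k % L)) ≡ 1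
unique-representative L k = subst (λ n → Σ₁ n (λ r → 𝟙 (r % L ≟ k % L)) ≡ 1) (*-identityˡ L) (congruence-count 1 L k)

spread : ∀ d k x .{{_ : NonZero d}} → Σ₁ d (λ j → 𝟙 (k % d ≟ j % d) * x) ≡ x
spread d k x = begin
  Σ₁ d (λ j → 𝟙 (k % d ≟ j % d) * x)   ≡⟨ Σ-*ʳ d x (λ i → 𝟙 (k % d ≟ suc i % d)) ⟩
  Σ₁ d (λ j → 𝟙 (k % d ≟ j % d)) * x   ≡⟨ cong (_* x) (Σ₁-cong d (λ j _ _ → 𝟙-≡-sym (k % d) (j % d))) ⟩
  Σ₁ d (λ j → 𝟙 (j % d ≟ k % d)) * x   ≡⟨ cong (_* x) (unique-representative d k) ⟩
  1 * x                                ≡⟨ *-identityˡ x ⟩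
  x                                    ∎
  where open ≡-Reasoning

unit-%≡ : ∀ {d x y} .{{_ : NonZero d}} → x % d ≡ y % d → 𝟙 (gcd x d ≟ 1) ≡ 𝟙 (gcd y d ≟ 1)
unit-%≡ {d} {x} {y} x≡y = 𝟙-cong (gcd x d ≟ 1) (gcd y d ≟ 1)
  (λ x⊥d → coprime⇒gcd≡1 (coprime-%≡ x≡y (gcd≡1⇒coprime x⊥d)))
  (λ y⊥d → coprime⇒gcd≡1 (coprime-%≡ (sym x≡y) (gcd≡1⇒coprime y⊥d)))

φ-as-sum : ∀ n → φ n ≡ Σ₁ n (λ k → 𝟙 (gcd k n ≟ 1))
φ-as-sum n = trans (length-filter (λ k → gcd k n ≟ 1) (range1 n)) (sum-range n (λ k → 𝟙 (gcd k n ≟ 1)))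

Σ∣ : ℕ → (ℕ → ℕ) → ℕ
Σ∣ n f = Σ₁ n (λ d → 𝟙 (d ∣? n) * f d)

Σ∣-cong : ∀ n {f g : ℕ → ℕ} → (∀ d → d ∣ n → f d ≡ g d) → Σ∣ n f ≡ Σ∣ n g
Σ∣-cong n f≗g = Σ₁-cong n (λ d _ _ → 𝟙-guard (d ∣? n) (f≗g d))

Σ∣-*ˡ : ∀ n c (f : ℕ → ℕ) → c * Σ∣ n f ≡ Σ∣ n (λ d → c * f d)
Σ∣-*ˡ n c f = trans (sym (Σ-*ˡ n c (λ i → 𝟙 (suc i ∣? n) * f (suc i))))
                    (Σ₁-cong n (λ d _ _ → x*[y*z]≡y*[x*z] c (𝟙 (d ∣? n)) (f d)))

Σ∣-*ʳ : ∀ n c (f : ℕ → ℕ) → Σ∣ n f * c ≡ Σ∣ n (λ d → f d * c)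
Σ∣-*ʳ n c f = trans (sym (Σ-*ʳ n c (λ i → 𝟙 (suc i ∣? n) * f (suc i))))
                    (Σ₁-cong n (λ d _ _ → *-assoc (𝟙 (d ∣? n)) (f d) c))

Σ∣-swap : ∀ M n (f : ℕ → ℕ → ℕ) → Σ₁ M (λ k → Σ∣ n (λ d → f k d)) ≡ Σ∣ n (λ d → Σ₁ M (λ k → f k d))
Σ∣-swap M n f = trans (Σ₁-swap M n (λ k d → 𝟙 (d ∣? n) * f k d))
                      (Σ₁-cong n (λ d _ _ → Σ-*ˡ M (𝟙 (d ∣? n)) (λ i → f (suc i) d)))

sum-divisors : ∀ n (f : ℕ → ℕ) → sum (map f (divisors n)) ≡ Σ∣ n f
sum-divisors n f = trans (sum-filter (λ d → d ∣? n) f (range1 n)) (sum-range n (λ d → 𝟙 (d ∣? n) * f d))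

Σ-multiples : ∀ c e (h : ℕ → ℕ) .{{_ : NonZero c}} →
              Σ₁ (c * e) (λ k → 𝟙 (c ∣? k) * h k) ≡ Σ₁ e (λ j → h (c * j))
Σ-multiples c zero h rewrite *-zeroʳ c = refl
Σ-multiples c@(suc c′) (suc e) h = begin
  Σ₁ (c * suc e) F                                  ≡⟨ cong (λ z → Σ₁ z F) c*[1+e]≡c*e+c ⟩
  Σ₁ (c * e + c) F                                  ≡⟨ Σ-split (c * e) c (λ i → F (suc i)) ⟩
  Σ₁ (c * e) F + Σ< c (λ i → F (suc (c * e + i)))   ≡⟨ cong₂ _+_ (Σ-multiples c e h) last-block ⟩
  Σ₁ e (λ j → h (c * j)) + h (c * suc e)            ∎
  where
  open ≡-Reasoning
  F : ℕ → ℕ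
  F k = 𝟙 (c ∣? k) * h k
  c*[1+e]≡c*e+c : c * suc e ≡ c * e + c
  c*[1+e]≡c*e+c = trans (*-suc c e) (+-comm c (c * e))
  top : suc (c * e + c′) ≡ c * suc e
  top = trans (sym (+-suc (c * e) c′)) (sym c*[1+e]≡c*e+c)
  in-block : ∀ i → i < c → F (suc (c * e + i)) ≡ 𝟙 (i ≟ c′) * h (c * suc e)
  in-block i i<c = trans (cong (_* h (suc (c * e + i))) (𝟙-cong (c ∣? suc (c * e + i)) (i ≟ c′) last first))
                         (𝟙-guard (i ≟ c′) (λ { refl → cong h top }))
    where
    last : c ∣ suc (c * e + i) → i ≡ c′
    last c∣ = suc-injective (≤-antisym i<c (∣⇒≤ (∣m+n∣m⇒∣n (subst (c ∣_) (sym (+-suc (c * e) i)) c∣) (m∣m*n e))))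
    first : i ≡ c′ → c ∣ suc (c * e + i)
    first refl = subst (c ∣_) (sym top) (m∣m*n (suc e))
  last-block : Σ< c (λ i → F (suc (c * e + i))) ≡ h (c * suc e)
  last-block = trans (Σ-cong c in-block) (Σ-single c c′ (λ _ → h (c * suc e)) ≤-refl)

-- The quotient n / e, made total by setting n // 0 = 0.
_//_ : ℕ → ℕ → ℕ
n // zero = 0
n // suc e = n / suc e

gcd-fiber : ∀ c e (f : ℕ → ℕ) .{{_ : NonZero c}} .{{_ : NonZero e}} →
            Σ₁ (c * e) (λ k → 𝟙 (e * gcd k (c * e) ≟ c * e) * f k) ≡ Σ₁ e (λ j → 𝟙 (gcd j e ≟ 1) * f (c * j))
gcd-fiber c e f = begin
  Σ₁ (c * e) (λ k → P k * f k)                    ≡⟨ Σ₁-cong (c * e) (λ k _ _ → only-multiples k) ⟩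
  Σ₁ (c * e) (λ k → 𝟙 (c ∣? k) * (P k * f k))     ≡⟨ Σ-multiples c e (λ k → P k * f k) ⟩
  Σ₁ e (λ j → P (c * j) * f (c * j))              ≡⟨ Σ₁-cong e (λ j _ _ → cong (_* f (c * j)) (on-multiples j)) ⟩
  Σ₁ e (λ j → 𝟙 (gcd j e ≟ 1) * f (c * j))        ∎
  where
  open ≡-Reasoning
  instance
    c*e≢0 : NonZero (c * e)
    c*e≢0 = m*n≢0 c e
  P : ℕ → ℕ
  P k = 𝟙 (e * gcd k (c * e) ≟ c * e)
  -- gcd(k, c·e) = c forces c ∣ k
  only-multiples : ∀ k → P k * f k ≡ 𝟙 (c ∣? k) * (P k * f k)
  only-multiples k = 𝟙-weaken (e * gcd k (c * e) ≟ c * e) (c ∣? k) c∣k (f k)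
    where
    c∣k : e * gcd k (c * e) ≡ c * e → c ∣ k
    c∣k eq = subst (_∣ k) (*-cancelˡ-≡ (gcd k (c * e)) c e (trans eq (*-comm c e))) (gcd[m,n]∣m k (c * e))
  scaled : ∀ j → e * gcd (c * j) (c * e) ≡ (c * e) * gcd j e
  scaled j = begin
    e * gcd (c * j) (c * e)   ≡⟨ cong (e *_) (c*gcd[m,n]≡gcd[cm,cn] c j e) ⟨
    e * (c * gcd j e)         ≡⟨ *-assoc e c (gcd j e) ⟨
    e * c * gcd j e           ≡⟨ cong (_* gcd j e) (*-comm e c) ⟩
    c * e * gcd j e           ∎
  on-multiples : ∀ j → P (c * j) ≡ 𝟙 (gcd j e ≟ 1)
  on-multiples j = 𝟙-cong (e * gcd (c * j) (c * e) ≟ c * e) (gcd j e ≟ 1)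
    (λ eq → *-cancelˡ-≡ (gcd j e) 1 (c * e) (trans (sym (scaled j)) (trans eq (sym (*-identityʳ (c * e))))))
    (λ eq → trans (scaled j) (trans (cong ((c * e) *_) eq) (*-identityʳ (c * e))))

gcd-class : ∀ n e (f : ℕ → ℕ) .{{_ : NonZero n}} .{{_ : NonZero e}} →
            Σ₁ n (λ k → 𝟙 (e * gcd k n ≟ n) * f k) ≡ 𝟙 (e ∣? n) * Σ₁ e (λ j → 𝟙 (gcd j e ≟ 1) * f ((n // e) * j))
gcd-class n e f with e ∣? n
... | no e∤n = Σ-zero n _ (λ i _ → 𝟙-kill (e * gcd (suc i) n ≟ n) (λ eq → e∤n (e∣n eq)) _)
  where
  e∣n : ∀ {g} → e * g ≡ n → e ∣ n
  e∣n {g} eq = divides g (trans (sym eq) (*-comm e g))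
gcd-class n e@(suc _) f | yes (divides c refl) = trans fiber (sym (+-identityʳ _))
  where
  instance
    c≢0 : NonZero c
    c≢0 = m*n≢0⇒m≢0 c
  fiber : Σ₁ (c * e) (λ k → 𝟙 (e * gcd k (c * e) ≟ c * e) * f k) ≡ Σ₁ e (λ j → 𝟙 (gcd j e ≟ 1) * f ((c * e / e) * j))
  fiber = trans (gcd-fiber c e f)
    (Σ₁-cong e (λ j _ _ → cong (λ q → 𝟙 (gcd j e ≟ 1) * f (q * j)) (sym (m*n/n≡m c e))))

-- Grouping k ∈ [1, n] according to e = n / gcd(k, n):
--   Σ_{k ≤ n} f(k) = Σ_{e ∣ n} Σ_{j ≤ e, gcd(j,e) = 1} f((n/e)·j).
divisor-decomposition : ∀ n (f : ℕ → ℕ) →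
  Σ₁ n f ≡ Σ∣ n (λ e → Σ₁ e (λ j → 𝟙 (gcd j e ≟ 1) * f ((n // e) * j)))
divisor-decomposition zero f = refl
divisor-decomposition n@(suc _) f = begin
  Σ₁ n f                                                 ≡⟨ Σ₁-cong n (λ k _ _ → one-class k) ⟩
  Σ₁ n (λ k → Σ₁ n (λ e → 𝟙 (e * gcd k n ≟ n) * f k))     ≡⟨ Σ₁-swap n n (λ k e → 𝟙 (e * gcd k n ≟ n) * f k) ⟩
  Σ₁ n (λ e → Σ₁ n (λ k → 𝟙 (e * gcd k n ≟ n) * f k))     ≡⟨ Σ₁-cong n class ⟩
  Σ∣ n (λ e → Σ₁ e (λ j → 𝟙 (gcd j e ≟ 1) * f ((n // e) * j))) ∎
  where
  open ≡-Reasoning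
  class : ∀ e → 1 ≤ e → e ≤ n → Σ₁ n (λ k → 𝟙 (e * gcd k n ≟ n) * f k) ≡
                                 𝟙 (e ∣? n) * Σ₁ e (λ j → 𝟙 (gcd j e ≟ 1) * f ((n // e) * j))
  class e@(suc _) _ _ = gcd-class n e f
  -- each k lies in exactly one class, namely e = n / gcd(k, n)
  one-class : ∀ k → f k ≡ Σ₁ n (λ e → 𝟙 (e * gcd k n ≟ n) * f k)
  one-class k with gcd[m,n]∣n k n
  ... | divides zero ()
  ... | divides v@(suc _) n≡v*g = sym (trans (Σ₁-cong n (λ e _ _ → cong (_* f k) (class-of-k e)))
                                                (Σ₁-single n v (λ _ → f k) (s≤s z≤n) v≤n))
    where
    g = gcd k n
    instance
      g≢0 : NonZero g
      g≢0 = ≢-nonZero (gcd[m,n]≢0 k n (inj₂ (λ ())))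
    class-of-k : ∀ e → 𝟙 (e * g ≟ n) ≡ 𝟙 (e ≟ v)
    class-of-k e = 𝟙-cong (e * g ≟ n) (e ≟ v) (λ eq → *-cancelʳ-≡ e v g (trans eq n≡v*g)) (λ { refl → sym n≡v*g })
    v≤n : v ≤ n
    v≤n = ∣⇒≤ (divides g (trans n≡v*g (*-comm v g)))

Σ₁-truncate : ∀ {h n} (F : ℕ → ℕ) → h ≤ n → (∀ i → h < i → F i ≡ 0) → Σ₁ n F ≡ Σ₁ h F
Σ₁-truncate {h} {n} F h≤n vanish = begin
  Σ₁ n F                                       ≡⟨ cong (λ z → Σ₁ z F) (m+[n∸m]≡n h≤n) ⟨
  Σ₁ (h + (n ∸ h)) F                           ≡⟨ Σ-split h (n ∸ h) (λ i → F (suc i)) ⟩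
  Σ₁ h F + Σ< (n ∸ h) (λ i → F (suc (h + i)))
    ≡⟨ cong (Σ₁ h F +_) (Σ-zero (n ∸ h) _ (λ i _ → vanish (suc (h + i)) (s≤s (m≤m+n h i)))) ⟩
  Σ₁ h F + 0                                   ≡⟨ +-identityʳ _ ⟩
  Σ₁ h F                                       ∎
  where open ≡-Reasoning

-- Gauss: Σ_{e ∣ n} φ(e) = n, the divisor decomposition of the constant function 1.
totient-divisor-sum : ∀ n → Σ∣ n φ ≡ n
totient-divisor-sum n = begin
  Σ∣ n φ                                          ≡⟨ Σ∣-cong n (λ e _ → φ-as-weighted-sum e) ⟩
  Σ∣ n (λ e → Σ₁ e (λ j → 𝟙 (gcd j e ≟ 1) * 1))    ≡⟨ divisor-decomposition n (λ _ → 1) ⟨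
  Σ₁ n (λ _ → 1)                                  ≡⟨ Σ-const n 1 ⟩
  n * 1                                           ≡⟨ *-identityʳ n ⟩
  n                                               ∎
  where
  open ≡-Reasoning
  φ-as-weighted-sum : ∀ e → φ e ≡ Σ₁ e (λ j → 𝟙 (gcd j e ≟ 1) * 1)
  φ-as-weighted-sum e = trans (φ-as-sum e) (Σ₁-cong e (λ j _ _ → sym (*-identityʳ (𝟙 (gcd j e ≟ 1)))))

-- gcd(x, n) = Σ_{d ∣ n, d ∣ x} φ(d): the common divisors of x and n are the divisors of gcd(x, n).
gcd-as-divisor-sum : ∀ x n .{{_ : NonZero n}} → gcd x n ≡ Σ∣ n (λ d → 𝟙 (d ∣? x) * φ d)
gcd-as-divisor-sum x n = sym (begin
  Σ₁ n (λ d → 𝟙 (d ∣? n) * (𝟙 (d ∣? x) * φ d))   ≡⟨ Σ₁-cong n (λ d _ _ → common-divisor d) ⟩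
  Σ₁ n (λ d → 𝟙 (d ∣? h) * φ d)                  ≡⟨ Σ₁-truncate _ (gcd[m,n]≤n x n) beyond-h ⟩
  Σ∣ h φ                                         ≡⟨ totient-divisor-sum h ⟩
  h                                              ∎)
  where
  open ≡-Reasoning
  h = gcd x n
  instance
    h≢0 : NonZero h
    h≢0 = ≢-nonZero (gcd[m,n]≢0 x n (inj₂ (≢-nonZero⁻¹ n)))
  common-divisor : ∀ d → 𝟙 (d ∣? n) * (𝟙 (d ∣? x) * φ d) ≡ 𝟙 (d ∣? h) * φ d
  common-divisor d = trans (sym (*-assoc (𝟙 (d ∣? n)) _ _)) (cong (_* φ d)
    (𝟙-* (d ∣? n) (d ∣? x) (d ∣? h) (λ d∣n d∣x → gcd-greatest d∣x d∣n)
         (λ d∣h → ∣-trans d∣h (gcd[m,n]∣n x n)) (λ d∣h → ∣-trans d∣h (gcd[m,n]∣m x n))))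
  beyond-h : ∀ d → h < d → 𝟙 (d ∣? h) * φ d ≡ 0
  beyond-h d h<d = 𝟙-kill (d ∣? h) (λ d∣h → <⇒≱ h<d (∣⇒≤ d∣h)) (φ d)

unitCount : ℕ → (ℓ : ℕ) → .{{NonZero ℓ}} → ℕ → ℕ → ℕ
unitCount M ℓ c r = Σ₁ M (λ k → 𝟙 (gcd k M ≟ 1) * 𝟙 ((c * k) % ℓ ≟ r % ℓ))

solutions-by-gcd : ∀ M ℓ c r .{{_ : NonZero ℓ}} →
  Σ₁ M (λ k → 𝟙 ((c * k) % ℓ ≟ r % ℓ)) ≡ Σ∣ M (λ e → unitCount e ℓ (c * (M // e)) r)
solutions-by-gcd M ℓ c r = trans (divisor-decomposition M (λ k → 𝟙 ((c * k) % ℓ ≟ r % ℓ)))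
  (Σ∣-cong M (λ e _ → Σ₁-cong e (λ k _ _ → cong (λ z → 𝟙 (gcd k e ≟ 1) * 𝟙 (z % ℓ ≟ r % ℓ)) (sym (*-assoc c (M // e) k)))))

unitCount-non-unit : ∀ e ℓ c c₀ r .{{_ : NonZero ℓ}} → ¬ Coprime c₀ ℓ → Coprime r ℓ → unitCount e ℓ (c * c₀) r ≡ 0
unitCount-non-unit e ℓ c c₀ r c₀∤ℓ r⊥ℓ = Σ-zero e _ (λ i _ → trans (*-comm (𝟙 (gcd (suc i) e ≟ 1)) _)
  (𝟙-kill ((c * c₀ * suc i) % ℓ ≟ r % ℓ) (λ eq → c₀∤ℓ (coprime-∣ˡ (coprime-%≡ (sym eq) r⊥ℓ) (c₀∣ (suc i)))) _))
  where
  c₀∣ : ∀ k → c₀ ∣ c * c₀ * k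
  c₀∣ k = ∣m⇒∣m*n k (n∣m*n c)

UnitCountIndependent : ℕ → Set
UnitCountIndependent M = ∀ ℓ .{{_ : NonZero ℓ}} → ℓ ∣ M → ∀ {c r c′ r′} →
  Coprime c ℓ → Coprime r ℓ → Coprime c′ ℓ → Coprime r′ ℓ → unitCount M ℓ c r ≡ unitCount M ℓ c′ r′

-- Strong induction on M: the M/ℓ solutions of c·k ≡ r (mod ℓ) in [1, M], grouped by
-- e = M / gcd(k, M), are unitCount M ℓ c r plus contributions of the proper divisors e
-- of M; each of those vanishes for every (c, r) or is independent of (c, r) by induction.
unitCount-independent : ∀ M → UnitCountIndependent M
unitCount-independent = <-rec UnitCountIndependent step
  where
  step : ∀ M → (∀ {e} → e < M → UnitCountIndependent e) → UnitCountIndependent M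
  step zero _ _ _ _ _ _ _ = refl
  step M@(suc M′) IH ℓ ℓ∣M {c} {r} {c′} {r′} c⊥ℓ r⊥ℓ c′⊥ℓ r′⊥ℓ =
    +-cancelˡ-≡ (proper c r) (unitCount M ℓ c r) (unitCount M ℓ c′ r′)
      (trans (decompose c r c⊥ℓ) (trans (sym (decompose c′ r′ c′⊥ℓ)) (cong (_+ unitCount M ℓ c′ r′) (sym proper-equal))))
    where
    proper : ℕ → ℕ → ℕ
    proper c r = Σ₁ M′ (λ e → 𝟙 (e ∣? M) * unitCount e ℓ (c * (M // e)) r)
    top : ∀ c r → 𝟙 (M ∣? M) * unitCount M ℓ (c * (M // M)) r ≡ unitCount M ℓ c r
    top c r = trans (𝟙-keep (M ∣? M) ∣-refl _) (cong (λ z → unitCount M ℓ z r) (trans (cong (c *_) (n/n≡1 M)) (*-identityʳ c)))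
    decompose : ∀ c r → Coprime c ℓ → proper c r + unitCount M ℓ c r ≡ quotient ℓ∣M
    decompose c r c⊥ℓ = begin
      proper c r + unitCount M ℓ c r                      ≡⟨ cong (proper c r +_) (top c r) ⟨
      Σ∣ M (λ e → unitCount e ℓ (c * (M // e)) r)         ≡⟨ solutions-by-gcd M ℓ c r ⟨
      Σ₁ M (λ k → 𝟙 ((c * k) % ℓ ≟ r % ℓ))
        ≡⟨ cong (λ n → Σ₁ n (λ k → 𝟙 ((c * k) % ℓ ≟ r % ℓ))) (_∣_.equality ℓ∣M) ⟩
      Σ₁ (quotient ℓ∣M * ℓ) (λ k → 𝟙 ((c * k) % ℓ ≟ r % ℓ)) ≡⟨ linear-congruence-count (quotient ℓ∣M) ℓ c r c⊥ℓ ⟩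
      quotient ℓ∣M                                        ∎
      where open ≡-Reasoning
    proper-term : ∀ e → 1 ≤ e → e ≤ M′ → e ∣ M → unitCount e ℓ (c * (M // e)) r ≡ unitCount e ℓ (c′ * (M // e)) r′
    proper-term e@(suc _) _ e≤M′ e∣M with Coprime.coprime? (M / e) ℓ
    ... | yes M/e⊥ℓ = IH (s≤s e≤M′) ℓ ℓ∣e (coprime-* c⊥ℓ M/e⊥ℓ) r⊥ℓ (coprime-* c′⊥ℓ M/e⊥ℓ) r′⊥ℓ
      where
      ℓ∣e : ℓ ∣ e
      ℓ∣e = coprime-divisor (Coprime.sym M/e⊥ℓ) (subst (ℓ ∣_) (sym (m/n*n≡m e∣M)) ℓ∣M)
    ... | no M/e∤ℓ = trans (unitCount-non-unit e ℓ c (M / e) r M/e∤ℓ r⊥ℓ)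
                           (sym (unitCount-non-unit e ℓ c′ (M / e) r′ M/e∤ℓ r′⊥ℓ))
    proper-equal : proper c r ≡ proper c′ r′
    proper-equal = Σ₁-cong M′ (λ e 1≤e e≤M′ → 𝟙-guard (e ∣? M) (proper-term e 1≤e e≤M′))

unitsInClass : ℕ → (ℓ : ℕ) → .{{NonZero ℓ}} → ℕ → ℕ
unitsInClass M ℓ r = Σ₁ M (λ k → 𝟙 (gcd k M ≟ 1) * 𝟙 (k % ℓ ≟ r % ℓ))

unitCount-1 : ∀ M ℓ r .{{_ : NonZero ℓ}} → unitCount M ℓ 1 r ≡ unitsInClass M ℓ r
unitCount-1 M ℓ r = Σ₁-cong M (λ k _ _ → cong (λ z → 𝟙 (gcd k M ≟ 1) * 𝟙 (z % ℓ ≟ r % ℓ)) (*-identityˡ k))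

-- Every unit modulo M lies in exactly one class r ∈ [1, ℓ], and that class is a unit
-- modulo ℓ; so the counts over the unit classes add up to φ(M).
unitsInClass-total : ∀ M ℓ .{{_ : NonZero ℓ}} → ℓ ∣ M → Σ₁ ℓ (λ r → 𝟙 (gcd r ℓ ≟ 1) * unitsInClass M ℓ r) ≡ φ M
unitsInClass-total M ℓ ℓ∣M = begin
  Σ₁ ℓ (λ r → 𝟙 (gcd r ℓ ≟ 1) * Σ₁ M (λ k → u k * C k r))
    ≡⟨ Σ₁-cong ℓ (λ r _ _ → sym (Σ-*ˡ M (𝟙 (gcd r ℓ ≟ 1)) (λ i → u (suc i) * C (suc i) r))) ⟩
  Σ₁ ℓ (λ r → Σ₁ M (λ k → 𝟙 (gcd r ℓ ≟ 1) * (u k * C k r)))  ≡⟨ Σ₁-swap ℓ M (λ r k → 𝟙 (gcd r ℓ ≟ 1) * (u k * C k r)) ⟩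
  Σ₁ M (λ k → Σ₁ ℓ (λ r → 𝟙 (gcd r ℓ ≟ 1) * (u k * C k r)))  ≡⟨ Σ₁-cong M (λ k _ _ → pull-out k) ⟩
  Σ₁ M (λ k → u k * Σ₁ ℓ (λ r → 𝟙 (gcd r ℓ ≟ 1) * C k r))    ≡⟨ Σ₁-cong M (λ k _ _ → 𝟙-guard (gcd k M ≟ 1) (one-class k)) ⟩
  Σ₁ M (λ k → u k * 1)                                      ≡⟨ Σ₁-cong M (λ k _ _ → *-identityʳ (u k)) ⟩
  Σ₁ M u                                                    ≡⟨ φ-as-sum M ⟨
  φ M                                                       ∎
  where
  open ≡-Reasoning
  u : ℕ → ℕ
  u k = 𝟙 (gcd k M ≟ 1)
  C : ℕ → ℕ → ℕ
  C k r = 𝟙 (k % ℓ ≟ r % ℓ)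
  pull-out : ∀ k → Σ₁ ℓ (λ r → 𝟙 (gcd r ℓ ≟ 1) * (u k * C k r)) ≡ u k * Σ₁ ℓ (λ r → 𝟙 (gcd r ℓ ≟ 1) * C k r)
  pull-out k = trans (Σ₁-cong ℓ (λ r _ _ → x*[y*z]≡y*[x*z] (𝟙 (gcd r ℓ ≟ 1)) (u k) (C k r)))
                     (Σ-*ˡ ℓ (u k) (λ i → 𝟙 (gcd (suc i) ℓ ≟ 1) * C k (suc i)))
  one-class : ∀ k → gcd k M ≡ 1 → Σ₁ ℓ (λ r → 𝟙 (gcd r ℓ ≟ 1) * C k r) ≡ 1
  one-class k k⊥M = trans (Σ₁-cong ℓ (λ r _ _ → unit-class r)) (unique-representative ℓ k)
    where
    k⊥ℓ : Coprime k ℓ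
    k⊥ℓ = coprime-∣ʳ (gcd≡1⇒coprime k⊥M) ℓ∣M
    unit-class : ∀ r → 𝟙 (gcd r ℓ ≟ 1) * C k r ≡ 𝟙 (r % ℓ ≟ k % ℓ)
    unit-class r = 𝟙-* (gcd r ℓ ≟ 1) (k % ℓ ≟ r % ℓ) (r % ℓ ≟ k % ℓ) (λ _ → sym)
      (λ r≡k → coprime⇒gcd≡1 (coprime-%≡ (sym r≡k) k⊥ℓ)) sym

units-equidistributed : ∀ M ℓ r .{{_ : NonZero ℓ}} → ℓ ∣ M → Coprime r ℓ → φ ℓ * unitsInClass M ℓ r ≡ φ M
units-equidistributed M ℓ r ℓ∣M r⊥ℓ = begin
  φ ℓ * unitsInClass M ℓ r                                    ≡⟨ cong (_* unitsInClass M ℓ r) (φ-as-sum ℓ) ⟩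
  Σ₁ ℓ (λ r′ → 𝟙 (gcd r′ ℓ ≟ 1)) * unitsInClass M ℓ r         ≡⟨ Σ-*ʳ ℓ (unitsInClass M ℓ r) (λ i → 𝟙 (gcd (suc i) ℓ ≟ 1)) ⟨
  Σ₁ ℓ (λ r′ → 𝟙 (gcd r′ ℓ ≟ 1) * unitsInClass M ℓ r)         ≡⟨ Σ₁-cong ℓ (λ r′ _ _ → 𝟙-guard (gcd r′ ℓ ≟ 1) (same-count r′)) ⟩
  Σ₁ ℓ (λ r′ → 𝟙 (gcd r′ ℓ ≟ 1) * unitsInClass M ℓ r′)        ≡⟨ unitsInClass-total M ℓ ℓ∣M ⟩
  φ M                                                         ∎
  where
  open ≡-Reasoning
  same-count : ∀ r′ → gcd r′ ℓ ≡ 1 → unitsInClass M ℓ r ≡ unitsInClass M ℓ r′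
  same-count r′ r′⊥ℓ = begin
    unitsInClass M ℓ r   ≡⟨ unitCount-1 M ℓ r ⟨
    unitCount M ℓ 1 r    ≡⟨ unitCount-independent M ℓ ℓ∣M (1-coprimeTo ℓ) r⊥ℓ (1-coprimeTo ℓ) (gcd≡1⇒coprime r′⊥ℓ) ⟩
    unitCount M ℓ 1 r′   ≡⟨ unitCount-1 M ℓ r′ ⟩
    unitsInClass M ℓ r′  ∎

gcd≢0 : ∀ m n .{{_ : NonZero m}} → NonZero (gcd m n)
gcd≢0 m n = ≢-nonZero (gcd[m,n]≢0 m n (inj₁ (≢-nonZero⁻¹ m)))

lcm≢0 : ∀ m n .{{_ : NonZero m}} .{{_ : NonZero n}} → NonZero (lcm m n)
lcm≢0 m n = ≢-nonZero λ lcm≡0 → ≢-nonZero⁻¹ (m * n) {{m*n≢0 m n}}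
  (trans (sym (gcd*lcm m n)) (trans (cong (gcd m n *_) lcm≡0) (*-zeroʳ (gcd m n))))

module _ (d₁ d₂ : ℕ) .{{_ : NonZero d₁}} .{{_ : NonZero d₂}} where

  private
    g = gcd d₁ d₂
    L = lcm d₁ d₂
    q = quotient (gcd[m,n]∣n d₁ d₂)
    instance
      g≢0 : NonZero g
      g≢0 = gcd≢0 d₁ d₂
      L≢0 : NonZero L
      L≢0 = lcm≢0 d₁ d₂

  lcm≡[d₂/gcd]*d₁ : L ≡ q * d₁
  lcm≡[d₂/gcd]*d₁ = *-cancelˡ-≡ L (q * d₁) g (begin
    g * L          ≡⟨ gcd*lcm d₁ d₂ ⟩
    d₁ * d₂        ≡⟨ cong (d₁ *_) (_∣_.equality (gcd[m,n]∣n d₁ d₂)) ⟩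
    d₁ * (q * g)   ≡⟨ x*[y*z]≡y*[x*z] d₁ q g ⟩
    q * (d₁ * g)   ≡⟨ cong (q *_) (*-comm d₁ g) ⟩
    q * (g * d₁)   ≡⟨ x*[y*z]≡y*[x*z] q g d₁ ⟩
    g * (q * d₁)   ∎)
    where open ≡-Reasoning

  crtSolutions : ℕ → ℕ → ℕ
  crtSolutions a j = Σ₁ L (λ k → 𝟙 (k % d₁ ≟ a % d₁) * 𝟙 (k % d₂ ≟ j % d₂))

  -- Each k ≡ a (mod d₁) in [1, L] is counted for exactly one j ∈ [1, d₂], and there are
  -- L / d₁ = d₂ / gcd(d₁, d₂) of them.
  crtSolutions-total : ∀ a → Σ₁ d₂ (crtSolutions a) ≡ q
  crtSolutions-total a = begin
    Σ₁ d₂ (λ j → Σ₁ L (λ k → A k * 𝟙 (k % d₂ ≟ j % d₂)))   ≡⟨ Σ₁-swap d₂ L (λ j k → A k * 𝟙 (k % d₂ ≟ j % d₂)) ⟩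
    Σ₁ L (λ k → Σ₁ d₂ (λ j → A k * 𝟙 (k % d₂ ≟ j % d₂)))   ≡⟨ Σ₁-cong L (λ k _ _ → one-class k) ⟩
    Σ₁ L A                                                ≡⟨ cong (λ n → Σ₁ n A) lcm≡[d₂/gcd]*d₁ ⟩
    Σ₁ (q * d₁) A                                         ≡⟨ congruence-count q d₁ a ⟩
    q                                                     ∎
    where
    open ≡-Reasoning
    A : ℕ → ℕ
    A k = 𝟙 (k % d₁ ≟ a % d₁)
    one-class : ∀ k → Σ₁ d₂ (λ j → A k * 𝟙 (k % d₂ ≟ j % d₂)) ≡ A k
    one-class k = trans (Σ₁-cong d₂ (λ j _ _ → *-comm (A k) (𝟙 (k % d₂ ≟ j % d₂)))) (spread d₂ k (A k))

  crtSolutions-≤ : ∀ a j (j≡a? : Dec (j % g ≡ a % g)) → crtSolutions a j ≤ 𝟙 j≡a?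
  crtSolutions-≤ a j (yes _) =
    ≤-trans (≤-reflexive (Σ₁-cong L (λ k _ _ → 𝟙-* (k % d₁ ≟ a % d₁) (k % d₂ ≟ j % d₂) (P? k) _,_ proj₁ proj₂)))
            (Σ-atMostOne L (P? ∘ suc) unique)
    where
    P : ℕ → Set
    P k = k % d₁ ≡ a % d₁ × k % d₂ ≡ j % d₂
    P? : ∀ k → Dec (P k)
    P? k = (k % d₁ ≟ a % d₁) ×-dec (k % d₂ ≟ j % d₂)
    unique : ∀ i i′ → i < L → i′ < L → P (suc i) → P (suc i′) → i ≡ i′
    unique i i′ i<L i′<L (a₁ , b₁) (a₂ , b₂) =
      suc-injective (%≡⇒≡ (s≤s z≤n) i<L (s≤s z≤n) i′<L (%≡-lcm (trans a₁ (sym a₂)) (trans b₁ (sym b₂))))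
  crtSolutions-≤ a j (no j≢a) = ≤-reflexive (Σ-zero L _ (λ i _ → no-solution (suc i)))
    where
    j≡a : ∀ {k} → k % d₁ ≡ a % d₁ → k % d₂ ≡ j % d₂ → j % g ≡ a % g
    j≡a k≡a k≡j = trans (%≡-∣ (gcd[m,n]∣n d₁ d₂) (sym k≡j)) (%≡-∣ (gcd[m,n]∣m d₁ d₂) k≡a)
    no-solution : ∀ k → 𝟙 (k % d₁ ≟ a % d₁) * 𝟙 (k % d₂ ≟ j % d₂) ≡ 0
    no-solution k = trans (𝟙-guard (k % d₁ ≟ a % d₁) (λ k≡a → 𝟙-no (k % d₂ ≟ j % d₂) (λ k≡j → j≢a (j≡a k≡a k≡j))))
                          (*-zeroʳ (𝟙 (k % d₁ ≟ a % d₁)))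

  -- Both sides add up to d₂ / gcd(d₁, d₂)
  -- over j ∈ [1, d₂], so the bound above is an equality by the counting principle.
  crt-count : ∀ a j → 1 ≤ j → j ≤ d₂ → crtSolutions a j ≡ 𝟙 (j % g ≟ a % g)
  crt-count a (suc j) _ j<d₂ =
    Σ-squeeze d₂ (crtSolutions a ∘ suc) (compatible ∘ suc) (λ i _ → crtSolutions-≤ a (suc i) (suc i % g ≟ a % g))
              totals j j<d₂
    where
    compatible : ℕ → ℕ
    compatible j = 𝟙 (j % g ≟ a % g)
    totals : Σ₁ d₂ (crtSolutions a) ≡ Σ₁ d₂ compatible
    totals = trans (crtSolutions-total a)
      (trans (sym (congruence-count q g a)) (cong (λ n → Σ₁ n compatible) (sym (_∣_.equality (gcd[m,n]∣n d₁ d₂)))))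

  -- The units k ≤ lcm(d₁, d₂) with k ≡ 1 (mod d₁) correspond to the units j ≤ d₂ with
  -- j ≡ 1 (mod gcd(d₁, d₂)), via j ≡ k (mod d₂) and the Chinese remainder theorem.
  unitsInClass-lcm≡unitsInClass-gcd : unitsInClass L d₁ 1 ≡ unitsInClass d₂ g 1
  unitsInClass-lcm≡unitsInClass-gcd = begin
    Σ₁ L (λ k → 𝟙 (gcd k L ≟ 1) * A k)                         ≡⟨ Σ₁-cong L (λ k _ _ → unit-mod-L⇔unit-mod-d₂ k) ⟩
    Σ₁ L (λ k → U k * A k)                                     ≡⟨ Σ₁-cong L (λ k _ _ → sym (spread d₂ k (U k * A k))) ⟩
    Σ₁ L (λ k → Σ₁ d₂ (λ j → B k j * (U k * A k)))             ≡⟨ Σ₁-swap L d₂ (λ k j → B k j * (U k * A k)) ⟩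
    Σ₁ d₂ (λ j → Σ₁ L (λ k → B k j * (U k * A k)))
      ≡⟨ Σ₁-cong d₂ (λ j _ _ → Σ₁-cong L (λ k _ _ → 𝟙-guard (k % d₂ ≟ j % d₂) (λ k≡j → cong (_* A k) (unit-%≡ k≡j)))) ⟩
    Σ₁ d₂ (λ j → Σ₁ L (λ k → B k j * (U j * A k)))
      ≡⟨ Σ₁-cong d₂ (λ j _ _ → Σ₁-cong L (λ k _ _ → x*[y*z]≡y*[z*x] (B k j) (U j) (A k))) ⟩
    Σ₁ d₂ (λ j → Σ₁ L (λ k → U j * (A k * B k j)))
      ≡⟨ Σ₁-cong d₂ (λ j _ _ → Σ-*ˡ L (U j) (λ i → A (suc i) * B (suc i) j)) ⟩
    Σ₁ d₂ (λ j → U j * Σ₁ L (λ k → A k * B k j))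
      ≡⟨ Σ₁-cong d₂ (λ j 1≤j j≤d₂ → cong (U j *_) (crt-count 1 j 1≤j j≤d₂)) ⟩
    Σ₁ d₂ (λ j → U j * 𝟙 (j % g ≟ 1 % g))                      ∎
    where
    open ≡-Reasoning
    U A : ℕ → ℕ
    U k = 𝟙 (gcd k d₂ ≟ 1)
    A k = 𝟙 (k % d₁ ≟ 1 % d₁)
    B : ℕ → ℕ → ℕ
    B k j = 𝟙 (k % d₂ ≟ j % d₂)
    -- any k ≡ 1 (mod d₁) is coprime to d₁, so it is a unit modulo lcm(d₁, d₂) iff it is one modulo d₂
    unit-mod-L⇔unit-mod-d₂ : ∀ k → 𝟙 (gcd k L ≟ 1) * A k ≡ U k * A k
    unit-mod-L⇔unit-mod-d₂ k = 𝟙-guardʳ (k % d₁ ≟ 1 % d₁) (λ k≡1 → 𝟙-cong (gcd k L ≟ 1) (gcd k d₂ ≟ 1)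
      (λ k⊥L → coprime⇒gcd≡1 (coprime-∣ʳ (gcd≡1⇒coprime {k} k⊥L) (n∣lcm[m,n] d₁ d₂)))
      (λ k⊥d₂ → coprime⇒gcd≡1 (coprime-lcm (coprime-%≡ (sym k≡1) (1-coprimeTo d₁)) (gcd≡1⇒coprime {k} k⊥d₂))))

  -- φ(d₁) · φ(d₂) = φ(lcm(d₁, d₂)) · φ(gcd(d₁, d₂)), by equidistribution applied to
  -- gcd(d₁, d₂) ∣ d₂ and d₁ ∣ lcm(d₁, d₂), whose class counts agree by the previous lemma.
  totient-lcm-gcd : φ d₁ * φ d₂ ≡ φ L * φ g
  totient-lcm-gcd = begin
    φ d₁ * φ d₂
      ≡⟨ cong (φ d₁ *_) (units-equidistributed d₂ g 1 (gcd[m,n]∣n d₁ d₂) (1-coprimeTo g)) ⟨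
    φ d₁ * (φ g * unitsInClass d₂ g 1)
      ≡⟨ x*[y*z]≡y*[x*z] (φ d₁) (φ g) _ ⟩
    φ g * (φ d₁ * unitsInClass d₂ g 1)
      ≡⟨ cong (λ z → φ g * (φ d₁ * z)) unitsInClass-lcm≡unitsInClass-gcd ⟨
    φ g * (φ d₁ * unitsInClass L d₁ 1)
      ≡⟨ cong (φ g *_) (units-equidistributed L d₁ 1 (m∣lcm[m,n] d₁ d₂) (1-coprimeTo d₁)) ⟩
    φ g * φ L
      ≡⟨ *-comm (φ g) (φ L) ⟩
    φ L * φ g
      ∎
    where open ≡-Reasoning

∣k-b∣≡b∸k : ∀ {k b} → k ≤ b → ∣ ℤ.+ k ℤ.- ℤ.+ b ∣ ≡ b ∸ k
∣k-b∣≡b∸k {k} {b} k≤b = trans (cong ∣_∣ (m-n≡m⊖n k b)) (∣⊖∣-≤ k≤b)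

∣k-b∣≡k∸b : ∀ {k b} → b ≤ k → ∣ ℤ.+ k ℤ.- ℤ.+ b ∣ ≡ k ∸ b
∣k-b∣≡k∸b {k} {b} b≤k = trans (cong ∣_∣ (m-n≡m⊖n k b)) (trans (∣m⊖n∣≡∣n⊖m∣ k b) (∣⊖∣-≤ b≤k))

∣k-b∣⇒%≡ : ∀ {ℓ k b} .{{_ : NonZero ℓ}} → ℓ ∣ ∣ ℤ.+ k ℤ.- ℤ.+ b ∣ → k % ℓ ≡ b % ℓ
∣k-b∣⇒%≡ {ℓ} {k} {b} ℓ∣ with ≤-total k b
... | inj₁ k≤b = ∣∸⇒%≡ k≤b (subst (ℓ ∣_) (∣k-b∣≡b∸k k≤b) ℓ∣)
... | inj₂ b≤k = sym (∣∸⇒%≡ b≤k (subst (ℓ ∣_) (∣k-b∣≡k∸b b≤k) ℓ∣))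

%≡⇒∣k-b∣ : ∀ {ℓ k b} .{{_ : NonZero ℓ}} → k % ℓ ≡ b % ℓ → ℓ ∣ ∣ ℤ.+ k ℤ.- ℤ.+ b ∣
%≡⇒∣k-b∣ {ℓ} {k} {b} eq with ≤-total k b
... | inj₁ k≤b = subst (ℓ ∣_) (sym (∣k-b∣≡b∸k k≤b)) (%≡⇒∣∸ eq k≤b)
... | inj₂ b≤k = subst (ℓ ∣_) (sym (∣k-b∣≡k∸b b≤k)) (%≡⇒∣∸ (sym eq) b≤k)

module _ (a : ℤ) (ℓ : ℕ) .{{_ : NonZero ℓ}} where

  private
    b = a %ℕ ℓ
    ℓ∣a-b : ℤ.+ ℓ ℤ∣.∣ a ℤ.- ℤ.+ b
    ℓ∣a-b = ℤ∣.divides (a /ℕ ℓ) (begin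
      a ℤ.- ℤ.+ b                               ≡⟨ cong (ℤ._- ℤ.+ b) (a≡a%ℕn+[a/ℕn]*n a ℓ) ⟩
      (ℤ.+ b ℤ.+ (a /ℕ ℓ) ℤ.* ℤ.+ ℓ) ℤ.- ℤ.+ b   ≡⟨ cancel (ℤ.+ b) ((a /ℕ ℓ) ℤ.* ℤ.+ ℓ) ⟩
      (a /ℕ ℓ) ℤ.* ℤ.+ ℓ                        ∎)
      where
      open ≡-Reasoning
      cancel : ∀ x y → (x ℤ.+ y) ℤ.- x ≡ y
      cancel = ℤ-solve-∀
    k-b≡[k-a]+[a-b] : ∀ k → ℤ.+ k ℤ.- ℤ.+ b ≡ (ℤ.+ k ℤ.- a) ℤ.+ (a ℤ.- ℤ.+ b)
    k-b≡[k-a]+[a-b] k = split (ℤ.+ k) a (ℤ.+ b)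
      where
      split : ∀ x y z → x ℤ.- z ≡ (x ℤ.- y) ℤ.+ (y ℤ.- z)
      split = ℤ-solve-∀

  ∣k-a∣⇒%≡ : ∀ k → ℓ ∣ ∣ ℤ.+ k ℤ.- a ∣ → k % ℓ ≡ b % ℓ
  ∣k-a∣⇒%≡ k ℓ∣k-a = ∣k-b∣⇒%≡ (∣⇒∣ᵤ (subst (ℤ.+ ℓ ℤ∣.∣_) (sym (k-b≡[k-a]+[a-b] k))
                                         (ℤ∣.∣m∣n⇒∣m+n (∣ᵤ⇒∣ {i = ℤ.+ k ℤ.- a} ℓ∣k-a) ℓ∣a-b)))

  %≡⇒∣k-a∣ : ∀ k → k % ℓ ≡ b % ℓ → ℓ ∣ ∣ ℤ.+ k ℤ.- a ∣
  %≡⇒∣k-a∣ k k≡b = ∣⇒∣ᵤ (ℤ∣.∣m+n∣n⇒∣m {m = ℤ.+ k ℤ.- a}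
                            (subst (ℤ.+ ℓ ℤ∣.∣_) (k-b≡[k-a]+[a-b] k) (∣ᵤ⇒∣ (%≡⇒∣k-b∣ k≡b))) ℓ∣a-b)

  coprime-residue : Coprime ∣ a ∣ ℓ → Coprime b ℓ
  coprime-residue a⊥ℓ {e} (e∣b , e∣ℓ) =
    a⊥ℓ (∣⇒∣ᵤ (subst (ℤ.+ e ℤ∣.∣_) (a-b+b≡a a (ℤ.+ b)) e∣a-b+b) , e∣ℓ)
    where
    a-b+b≡a : ∀ x y → (x ℤ.- y) ℤ.+ y ≡ x
    a-b+b≡a = ℤ-solve-∀
    e∣a-b+b : ℤ.+ e ℤ∣.∣ (a ℤ.- ℤ.+ b) ℤ.+ ℤ.+ b
    e∣a-b+b = ℤ∣.∣m∣n⇒∣m+n (ℤ∣.∣-trans (∣ᵤ⇒∣ e∣ℓ) ℓ∣a-b) (∣ᵤ⇒∣ e∣b)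

∣-nonZero : ∀ {d n} .{{_ : NonZero n}} → d ∣ n → NonZero d
∣-nonZero (divides q refl) = m*n≢0⇒n≢0 q

Σ∣-product : ∀ c n m (f g : ℕ → ℕ) → c * (Σ∣ n f * Σ∣ m g) ≡ Σ∣ n (λ i → Σ∣ m (λ j → c * (f i * g j)))
Σ∣-product c n m f g = begin
  c * (Σ∣ n f * Σ∣ m g)                       ≡⟨ cong (c *_) (Σ∣-*ʳ n (Σ∣ m g) f) ⟩
  c * Σ∣ n (λ i → f i * Σ∣ m g)               ≡⟨ Σ∣-*ˡ n c (λ i → f i * Σ∣ m g) ⟩
  Σ∣ n (λ i → c * (f i * Σ∣ m g))
    ≡⟨ Σ∣-cong n (λ i _ → trans (cong (c *_) (Σ∣-*ˡ m (f i) g)) (Σ∣-*ˡ m c (λ j → f i * g j))) ⟩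
  Σ∣ n (λ i → Σ∣ m (λ j → c * (f i * g j)))   ∎
  where open ≡-Reasoning

gcd-product-expansion : ∀ M m₁ m₂ (u x : ℕ → ℕ) .{{_ : NonZero m₁}} .{{_ : NonZero m₂}} →
  Σ₁ M (λ k → u k * (gcd (x k) m₁ * gcd (x k) m₂)) ≡
  Σ∣ m₁ (λ d₁ → Σ∣ m₂ (λ d₂ → Σ₁ M (λ k → u k * ((𝟙 (d₁ ∣? x k) * φ d₁) * (𝟙 (d₂ ∣? x k) * φ d₂)))))
gcd-product-expansion M m₁ m₂ u x = begin
  Σ₁ M (λ k → u k * (gcd (x k) m₁ * gcd (x k) m₂))
    ≡⟨ Σ₁-cong M (λ k _ _ → cong (u k *_) (cong₂ _*_ (gcd-as-divisor-sum (x k) m₁) (gcd-as-divisor-sum (x k) m₂))) ⟩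
  Σ₁ M (λ k → u k * (Σ∣ m₁ (F k) * Σ∣ m₂ (F k)))
    ≡⟨ Σ₁-cong M (λ k _ _ → Σ∣-product (u k) m₁ m₂ (F k) (F k)) ⟩
  Σ₁ M (λ k → Σ∣ m₁ (λ d₁ → Σ∣ m₂ (λ d₂ → u k * (F k d₁ * F k d₂))))
    ≡⟨ Σ∣-swap M m₁ (λ k d₁ → Σ∣ m₂ (λ d₂ → u k * (F k d₁ * F k d₂))) ⟩
  Σ∣ m₁ (λ d₁ → Σ₁ M (λ k → Σ∣ m₂ (λ d₂ → u k * (F k d₁ * F k d₂))))
    ≡⟨ Σ∣-cong m₁ (λ d₁ _ → Σ∣-swap M m₂ (λ k d₂ → u k * (F k d₁ * F k d₂))) ⟩
  Σ∣ m₁ (λ d₁ → Σ∣ m₂ (λ d₂ → Σ₁ M (λ k → u k * (F k d₁ * F k d₂))))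
    ∎
  where
  open ≡-Reasoning
  F : ℕ → ℕ → ℕ
  F k d = 𝟙 (d ∣? x k) * φ d

-- The contribution of one pair of divisors: the units k ≤ M with d₁, d₂ ∣ k − a are the units
-- in the class of a modulo ℓ = lcm(d₁, d₂); weighted by φ(d₁)φ(d₂) = φ(ℓ)φ(gcd(d₁, d₂)),
-- equidistribution turns their number into φ(M)·φ(gcd(d₁, d₂)).
pair-contribution : ∀ M d₁ d₂ (a : ℤ) .{{_ : NonZero d₁}} .{{_ : NonZero d₂}} →
  lcm d₁ d₂ ∣ M → Coprime ∣ a ∣ (lcm d₁ d₂) →
  Σ₁ M (λ k → 𝟙 (gcd k M ≟ 1) * ((𝟙 (d₁ ∣? ∣ ℤ.+ k ℤ.- a ∣) * φ d₁) * (𝟙 (d₂ ∣? ∣ ℤ.+ k ℤ.- a ∣) * φ d₂)))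
    ≡ φ M * φ (gcd d₁ d₂)
pair-contribution M d₁ d₂ a ℓ∣M a⊥ℓ = begin
  Σ₁ M (λ k → u k * ((D₁ k * φ d₁) * (D₂ k * φ d₂)))   ≡⟨ Σ₁-cong M (λ k _ _ → pointwise k) ⟩
  Σ₁ M (λ k → (φ d₁ * φ d₂) * (u k * C k))              ≡⟨ Σ-*ˡ M (φ d₁ * φ d₂) (λ i → u (suc i) * C (suc i)) ⟩
  (φ d₁ * φ d₂) * unitsInClass M ℓ b                    ≡⟨ cong (_* unitsInClass M ℓ b) (totient-lcm-gcd d₁ d₂) ⟩
  (φ ℓ * φ g) * unitsInClass M ℓ b                      ≡⟨ cong (_* unitsInClass M ℓ b) (*-comm (φ ℓ) (φ g)) ⟩
  (φ g * φ ℓ) * unitsInClass M ℓ b                      ≡⟨ *-assoc (φ g) (φ ℓ) _ ⟩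
  φ g * (φ ℓ * unitsInClass M ℓ b)
    ≡⟨ cong (φ g *_) (units-equidistributed M ℓ b ℓ∣M (coprime-residue a ℓ a⊥ℓ)) ⟩
  φ g * φ M                                             ≡⟨ *-comm (φ g) (φ M) ⟩
  φ M * φ g                                             ∎
  where
  open ≡-Reasoning
  ℓ = lcm d₁ d₂
  g = gcd d₁ d₂
  instance
    ℓ≢0 : NonZero ℓ
    ℓ≢0 = lcm≢0 d₁ d₂
  b = a %ℕ ℓ
  u D₁ D₂ C : ℕ → ℕ
  u k = 𝟙 (gcd k M ≟ 1)
  D₁ k = 𝟙 (d₁ ∣? ∣ ℤ.+ k ℤ.- a ∣)
  D₂ k = 𝟙 (d₂ ∣? ∣ ℤ.+ k ℤ.- a ∣)
  C k = 𝟙 (k % ℓ ≟ b % ℓ)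
  -- d₁ and d₂ both divide k − a iff ℓ does, i.e. iff k ≡ a (mod ℓ)
  both-divide : ∀ k → D₁ k * D₂ k ≡ C k
  both-divide k = 𝟙-* (d₁ ∣? ∣ ℤ.+ k ℤ.- a ∣) (d₂ ∣? ∣ ℤ.+ k ℤ.- a ∣) (k % ℓ ≟ b % ℓ)
    (λ d₁∣ d₂∣ → ∣k-a∣⇒%≡ a ℓ k (lcm-least d₁∣ d₂∣))
    (λ k≡b → ∣-trans (m∣lcm[m,n] d₁ d₂) (%≡⇒∣k-a∣ a ℓ k k≡b))
    (λ k≡b → ∣-trans (n∣lcm[m,n] d₁ d₂) (%≡⇒∣k-a∣ a ℓ k k≡b))
  pointwise : ∀ k → u k * ((D₁ k * φ d₁) * (D₂ k * φ d₂)) ≡ (φ d₁ * φ d₂) * (u k * C k)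
  pointwise k = trans (regroup (u k) (D₁ k) (φ d₁) (D₂ k) (φ d₂))
                      (cong (λ z → (φ d₁ * φ d₂) * (u k * z)) (both-divide k))
    where
    regroup : ∀ u D₁ p₁ D₂ p₂ → u * ((D₁ * p₁) * (D₂ * p₂)) ≡ (p₁ * p₂) * (u * (D₁ * D₂))
    regroup = solve-∀

lhs-as-sum : ∀ M a m₁ m₂ →
             lhsSum M a m₁ m₂ ≡ Σ₁ M (λ k → 𝟙 (gcd k M ≟ 1) * (gcdℤ (ℤ.+ k ℤ.- a) m₁ * gcdℤ (ℤ.+ k ℤ.- a) m₂))
lhs-as-sum M a m₁ m₂ = trans (sum-filter (λ k → gcd k M ≟ 1) _ (range1 M)) (sum-range M _)

rhs-as-sum : ∀ m₁ m₂ → rhsSum m₁ m₂ ≡ Σ∣ m₁ (λ d₁ → Σ∣ m₂ (λ d₂ → φ (gcd d₁ d₂)))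
rhs-as-sum m₁ m₂ = trans (sum-concatMap inner (divisors m₁))
  (trans (sum-divisors m₁ (sum ∘ inner)) (Σ∣-cong m₁ (λ d₁ _ → sum-divisors m₂ (λ d₂ → φ (gcd d₁ d₂)))))
  where
  inner = λ d₁ → map (λ d₂ → φ (gcd d₁ d₂)) (divisors m₂)

corollary11 : (m₁ m₂ M : ℕ) → .{{NonZero m₁}} → .{{NonZero m₂}} → .{{NonZero M}} →
              (a : ℤ) → lcm m₁ m₂ ∣ M → gcdℤ a (lcm m₁ m₂) ≡ 1 →
              lhsSum M a m₁ m₂ ≡ φ M * rhsSum m₁ m₂
corollary11 m₁ m₂ M a m∣M a⊥m = begin
  lhsSum M a m₁ m₂
    ≡⟨ lhs-as-sum M a m₁ m₂ ⟩
  Σ₁ M (λ k → u k * (gcd (x k) m₁ * gcd (x k) m₂))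
    ≡⟨ gcd-product-expansion M m₁ m₂ u x ⟩
  Σ∣ m₁ (λ d₁ → Σ∣ m₂ (λ d₂ → Σ₁ M (λ k → u k * ((𝟙 (d₁ ∣? x k) * φ d₁) * (𝟙 (d₂ ∣? x k) * φ d₂)))))
    ≡⟨ Σ∣-cong m₁ (λ d₁ d₁∣m₁ → Σ∣-cong m₂ (λ d₂ d₂∣m₂ → pair d₁∣m₁ d₂∣m₂)) ⟩
  Σ∣ m₁ (λ d₁ → Σ∣ m₂ (λ d₂ → φ M * φ (gcd d₁ d₂)))
    ≡⟨ Σ∣-cong m₁ (λ d₁ _ → Σ∣-*ˡ m₂ (φ M) (λ d₂ → φ (gcd d₁ d₂))) ⟨
  Σ∣ m₁ (λ d₁ → φ M * Σ∣ m₂ (λ d₂ → φ (gcd d₁ d₂)))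
    ≡⟨ Σ∣-*ˡ m₁ (φ M) (λ d₁ → Σ∣ m₂ (λ d₂ → φ (gcd d₁ d₂))) ⟨
  φ M * Σ∣ m₁ (λ d₁ → Σ∣ m₂ (λ d₂ → φ (gcd d₁ d₂)))
    ≡⟨ cong (φ M *_) (rhs-as-sum m₁ m₂) ⟨
  φ M * rhsSum m₁ m₂
    ∎
  where
  open ≡-Reasoning
  u x : ℕ → ℕ
  u k = 𝟙 (gcd k M ≟ 1)
  x k = ∣ ℤ.+ k ℤ.- a ∣
  -- each pair d₁ ∣ m₁, d₂ ∣ m₂ has lcm(d₁, d₂) ∣ m ∣ M and a is a unit modulo lcm(d₁, d₂)
  pair : ∀ {d₁ d₂} → d₁ ∣ m₁ → d₂ ∣ m₂ →
         Σ₁ M (λ k → u k * ((𝟙 (d₁ ∣? x k) * φ d₁) * (𝟙 (d₂ ∣? x k) * φ d₂))) ≡ φ M * φ (gcd d₁ d₂)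
  pair {d₁} {d₂} d₁∣m₁ d₂∣m₂ = pair-contribution M d₁ d₂ a {{∣-nonZero d₁∣m₁}} {{∣-nonZero d₂∣m₂}}
    (∣-trans ℓ∣m m∣M) (coprime-∣ʳ (gcd≡1⇒coprime a⊥m) ℓ∣m)
    where
    ℓ∣m : lcm d₁ d₂ ∣ lcm m₁ m₂
    ℓ∣m = lcm-least (∣-trans d₁∣m₁ (m∣lcm[m,n] m₁ m₂)) (∣-trans d₂∣m₂ (n∣lcm[m,n] m₁ m₂))
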